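{- Let $G_5=(V,E)$ be the digraph with $V=\{v_1,v_2,w_1,w_2\}$ and $E=\{(v_1,v_2),(v_1,w_1),(v_1,w_2),(v_2,w_1),(v_2,w_2)\}$. Consider Digraph Yama Nim on $G_5$, i.e. the impartial game with positions $(x,y,z_1,z_2)\in\mathbb{Z}_{\ge0}^4$ ($x$ tokens on $v_1$, $y$ on $v_2$, $z_i$ on $w_i$) whose options from $(x,y,z_1,z_2)$ are $(x-i,y+1,z_1+1,z_2+1)$ for $4\le i\le x$; $(x,y-i,z_1+1,z_2+1)$ for $3\le i\le y$; $(x,y,z_1-i,z_2)$ for $1\le i\le z_1$; and $(x,y,z_1,z_2-i)$ for $1\le i\le z_2$. Under normal play, the set of $\mathcal{P}$-positions is $S_1\cup S_2$, where $$S_1=\left\{(x,y,z_1,z_2)\in\mathbb{Z}_{\ge0}^4 \;\middle|\; 2\left\lfloor \tfrac{x}{4}\right\rfloor\le y\le 2\left\lfloor \tfrac{x}{4}\right\rfloor+2 \text{ and } z_1\oplus z_2=0\right\},$$ $$S_2=\left\{(x,y,z_1,z_2)\in\mathbb{Z}_{\ge0}^4 \;\middle|\; \left(y<2\left\lfloor \tfrac{x}{4}\right\rfloor \text{ or } 2\left\lfloor \tfrac{x}{4}\right\rfloor+2<y\right) \text{ and } z_1\oplus z_2=1\right\}.$$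
   Context: Normal play: the player making the last move wins (a player with no options loses). A $\mathcal{P}$-position is one where the previous player (not the player to move) has a winning strategy. $\oplus$ denotes bitwise XOR of non-negative integers. -}

module Defs where

open import Data.Nat using (ℕ; zero; suc; _+_; _*_; _∸_; _≤_; _<_)
open import Data.Nat.DivMod using (_/_; _%_)
open import Data.Product using (_×_; _,_; Σ)
open import Data.Sum using (_⊎_)
open import Relation.Binary.PropositionalEquality using (_≡_)

-- Bitwise XOR on ℕ, by binary recursion with fuel (m + n suffices,
-- since the sum strictly decreases while nonzero and xor 0 0 = 0).
bitxor : ℕ → ℕ → ℕ
bitxor zero zero = 0
bitxor zero (suc _) = 1
bitxor (suc _) zero = 1
bitxor (suc _) (suc _) = 0

xorFuel : ℕ → ℕ → ℕ → ℕ
xorFuel zero m n = 0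
xorFuel (suc f) m n = bitxor (m % 2) (n % 2) + 2 * xorFuel f (m / 2) (n / 2)

_⊕_ : ℕ → ℕ → ℕ
m ⊕ n = xorFuel (m + n) m n

Pos : Set
Pos = ℕ × ℕ × ℕ × ℕ

data Option : Pos → Pos → Set where
  move-v₁ : ∀ {x y z₁ z₂} i → 4 ≤ i → i ≤ x →
            Option (x , y , z₁ , z₂) (x ∸ i , suc y , suc z₁ , suc z₂)
  move-v₂ : ∀ {x y z₁ z₂} i → 3 ≤ i → i ≤ y →
            Option (x , y , z₁ , z₂) (x , y ∸ i , suc z₁ , suc z₂)
  move-w₁ : ∀ {x y z₁ z₂} i → 1 ≤ i → i ≤ z₁ →
            Option (x , y , z₁ , z₂) (x , y , z₁ ∸ i , z₂)
  move-w₂ : ∀ {x y z₁ z₂} i → 1 ≤ i → i ≤ z₂ →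
            Option (x , y , z₁ , z₂) (x , y , z₁ , z₂ ∸ i)

-- Normal-play outcome classes, defined inductively (the game is
-- short: every play terminates).
data IsP : Pos → Set
data IsN : Pos → Set

data IsP where
  isP : ∀ {p} → (∀ q → Option p q → IsN q) → IsP p

data IsN where
  isN : ∀ {p} q → Option p q → IsP q → IsN p

S₁ : Pos → Set
S₁ (x , y , z₁ , z₂) = (2 * (x / 4) ≤ y × y ≤ 2 * (x / 4) + 2) × (z₁ ⊕ z₂ ≡ 0)

S₂ : Pos → Set
S₂ (x , y , z₁ , z₂) = (y < 2 * (x / 4) ⊎ 2 * (x / 4) + 2 < y) × (z₁ ⊕ z₂ ≡ 1)

-- Every move lowers the token count x + y + z₁ + z₂ (v₁ loses at least four tokens and
-- passes on three, v₂ loses at least three and passes on two), so the game is short and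
-- its P-positions form the unique kernel of the move digraph: a set with no move inside
-- it that is entered in one move from every position outside it.  Write partner n for
-- n ⊕ 1.  The claimed set consists of the positions whose w-heaps satisfy z₂ = z₁ when
-- 2⌊x/4⌋ ≤ y ≤ 2⌊x/4⌋ + 2 (in the band) and z₂ = partner z₁ otherwise.  A move from v₁
-- or v₂ adds a token to both w-heaps, which preserves z₂ = z₁ but turns z₂ = partner z₁
-- into neither relation; it carries every in-band position out of the band, and from
-- outside the band some such move enters it.  A move on one w-heap keeps the band, and
-- as in two-heap Nim it restores the relation whenever it fails, because both pairings
-- are involutions that raise no number by more than one.
module Submission where

open import Data.Nat
open import Data.Nat.DivMod
open import Data.Nat.Divisibility using (∣-refl)
open import Data.Nat.Induction using (<-wellFounded)
open import Data.Nat.Properties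
open import Data.Nat.Tactic.RingSolver using (solve-∀)
open import Data.Product using (_×_; _,_; proj₁; proj₂; ∃-syntax; ∃₂)
open import Data.Sum using (_⊎_; inj₁; inj₂)
open import Function using (flip; _∘_)
open import Function.Bundles using (_⇔_; mk⇔; Equivalence)
open import Induction.WellFounded using (WellFounded; module All; module Subrelation)
open import Level using (0ℓ)
import Relation.Binary.Construct.On as On
open import Relation.Binary.Definitions using (tri<; tri≈; tri>)
open import Relation.Binary.PropositionalEquality
open import Relation.Nullary using (¬_; yes; no; contradiction)
open import Relation.Unary using (Pred)

open import Defs
open import Algebra.Definitions {A = ℕ} _≡_ using (Involutive)

partner : ℕ → ℕ
partner 0 = 1
partner 1 = 0
partner (suc (suc n)) = suc (suc (partner n))

partner-involutive : Involutive partner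
partner-involutive 0 = refl
partner-involutive 1 = refl
partner-involutive (suc (suc n)) = cong (suc ∘ suc) (partner-involutive n)

partner-injective : ∀ {m n} → partner m ≡ partner n → m ≡ n
partner-injective {m} {n} eq = begin
  m                   ≡⟨ partner-involutive m ⟨
  partner (partner m) ≡⟨ cong partner eq ⟩
  partner (partner n) ≡⟨ partner-involutive n ⟩
  n                   ∎
  where open ≡-Reasoning

partner≢ : ∀ n → partner n ≢ n
partner≢ (suc (suc n)) eq = partner≢ n (suc-injective (suc-injective eq))

partner-suc≢suc-partner : ∀ n → partner (suc n) ≢ suc (partner n)
partner-suc≢suc-partner (suc (suc n)) eq =
  partner-suc≢suc-partner n (suc-injective (suc-injective eq))

partner≤suc : ∀ n → partner n ≤ suc n
partner≤suc 0 = s≤s z≤n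
partner≤suc 1 = z≤n
partner≤suc (suc (suc n)) = s≤s (s≤s (partner≤suc n))

[2+n]/2≡1+n/2 : ∀ n → suc (suc n) / 2 ≡ suc (n / 2)
[2+n]/2≡1+n/2 n = m/n≡1+[m∸n]/n {suc (suc n)} {2} (s≤s (s≤s z≤n))

[2+n]%2≡n%2 : ∀ n → suc (suc n) % 2 ≡ n % 2
[2+n]%2≡n%2 n = trans (cong (_% 2) (+-comm 2 n)) ([m+n]%n≡m%n n 2)

partner-/2 : ∀ n → partner n / 2 ≡ n / 2
partner-/2 0 = refl
partner-/2 1 = refl
partner-/2 (suc (suc n))
  rewrite [2+n]/2≡1+n/2 (partner n) | [2+n]/2≡1+n/2 n = cong suc (partner-/2 n)

partner-%2 : ∀ n → partner n % 2 ≡ partner (n % 2)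
partner-%2 0 = refl
partner-%2 1 = refl
partner-%2 (suc (suc n)) rewrite [2+n]%2≡n%2 (partner n) | [2+n]%2≡n%2 n = partner-%2 n

bitxor-self : ∀ b → bitxor b b ≡ 0
bitxor-self zero = refl
bitxor-self (suc b) = refl

bitxor-partner : ∀ {b} → b < 2 → bitxor b (partner b) ≡ 1
bitxor-partner {0} _ = refl
bitxor-partner {1} _ = refl
bitxor-partner {2+ _} (s≤s (s≤s ()))

bitxor≡0⇒≡ : ∀ {a b} → a < 2 → b < 2 → bitxor a b ≡ 0 → a ≡ b
bitxor≡0⇒≡ {0} {0} _ _ _ = refl
bitxor≡0⇒≡ {1} {1} _ _ _ = refl
bitxor≡0⇒≡ {2+ _} (s≤s (s≤s ()))
bitxor≡0⇒≡ {_} {2+ _} _ (s≤s (s≤s ()))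

bitxor≡1⇒≡partner : ∀ {a b} → a < 2 → b < 2 → bitxor a b ≡ 1 → b ≡ partner a
bitxor≡1⇒≡partner {0} {1} _ _ _ = refl
bitxor≡1⇒≡partner {1} {0} _ _ _ = refl
bitxor≡1⇒≡partner {2+ _} (s≤s (s≤s ()))
bitxor≡1⇒≡partner {_} {2+ _} _ (s≤s (s≤s ()))

≡-by-halves : ∀ {m n} → m % 2 ≡ n % 2 → m / 2 ≡ n / 2 → m ≡ n
≡-by-halves {m} {n} eq% eq/ = begin
  m                 ≡⟨ m≡m%n+[m/n]*n m 2 ⟩
  m % 2 + m / 2 * 2 ≡⟨ cong₂ (λ r q → r + q * 2) eq% eq/ ⟩
  n % 2 + n / 2 * 2 ≡⟨ m≡m%n+[m/n]*n n 2 ⟨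
  n                 ∎
  where open ≡-Reasoning

n≤1+f⇒n/2≤f : ∀ {n f} → n ≤ suc f → n / 2 ≤ f
n≤1+f⇒n/2≤f {zero} _ = z≤n
n≤1+f⇒n/2≤f {suc n} le = ≤-pred (≤-trans (m/n<m (suc n) 2 (s≤s (s≤s z≤n))) le)

b+2*r≡0 : ∀ b {r} → b + 2 * r ≡ 0 → b ≡ 0 × r ≡ 0
b+2*r≡0 zero {zero} _ = refl , refl

b+2*r≡1 : ∀ b {r} → b + 2 * r ≡ 1 → b ≡ 1 × r ≡ 0
b+2*r≡1 zero {suc r} eq rewrite +-suc r (r + 0) = contradiction (suc-injective eq) λ ()
b+2*r≡1 (suc zero) {zero} _ = refl , refl

-- Each step of xorFuel halves both arguments, so fuel f suffices for arguments ≤ f.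
xorFuel≡0⇒≡ : ∀ f {m n} → m ≤ f → n ≤ f → xorFuel f m n ≡ 0 → m ≡ n
xorFuel≡0⇒≡ zero z≤n z≤n _ = refl
xorFuel≡0⇒≡ (suc f) {m} {n} m≤ n≤ eq with b+2*r≡0 (bitxor (m % 2) (n % 2)) eq
... | low≡0 , high≡0 =
  ≡-by-halves (bitxor≡0⇒≡ (m%n<n m 2) (m%n<n n 2) low≡0)
              (xorFuel≡0⇒≡ f (n≤1+f⇒n/2≤f m≤) (n≤1+f⇒n/2≤f n≤) high≡0)

xorFuel≡1⇒≡partner : ∀ f {m n} → m ≤ f → n ≤ f → xorFuel f m n ≡ 1 → n ≡ partner m
xorFuel≡1⇒≡partner (suc f) {m} {n} m≤ n≤ eq with b+2*r≡1 (bitxor (m % 2) (n % 2)) eq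
... | low≡1 , high≡0 = ≡-by-halves
  (trans (bitxor≡1⇒≡partner (m%n<n m 2) (m%n<n n 2) low≡1) (sym (partner-%2 m)))
  (trans (sym (xorFuel≡0⇒≡ f (n≤1+f⇒n/2≤f m≤) (n≤1+f⇒n/2≤f n≤) high≡0)) (sym (partner-/2 m)))

xorFuel-self : ∀ f n → xorFuel f n n ≡ 0
xorFuel-self zero n = refl
xorFuel-self (suc f) n rewrite bitxor-self (n % 2) | xorFuel-self f (n / 2) = refl

⊕≡0⇒≡ : ∀ {m n} → m ⊕ n ≡ 0 → m ≡ n
⊕≡0⇒≡ {m} {n} = xorFuel≡0⇒≡ (m + n) (m≤m+n m n) (m≤n+m n m)

⊕≡1⇒≡partner : ∀ {m n} → m ⊕ n ≡ 1 → n ≡ partner m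
⊕≡1⇒≡partner {m} {n} = xorFuel≡1⇒≡partner (m + n) (m≤m+n m n) (m≤n+m n m)

n⊕n≡0 : ∀ n → n ⊕ n ≡ 0
n⊕n≡0 n = xorFuel-self (n + n) n

xorFuel-partner : ∀ f n → xorFuel (suc f) n (partner n) ≡ 1
xorFuel-partner f n
  rewrite partner-%2 n | bitxor-partner (m%n<n n 2) | partner-/2 n | xorFuel-self f (n / 2)
  = refl

n⊕partner≡1 : ∀ n → n ⊕ partner n ≡ 1
n⊕partner≡1 zero = refl
n⊕partner≡1 (suc n) = xorFuel-partner (n + partner (suc n)) (suc n)

tokens : Pos → ℕ
tokens (x , y , z₁ , z₂) = x + (y + (z₁ + z₂))

k+[m∸i]≤m : ∀ {k i m} → k ≤ i → i ≤ m → k + (m ∸ i) ≤ m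
k+[m∸i]≤m {k} {i} {m} k≤i i≤m = ≤-trans (+-monoˡ-≤ (m ∸ i) k≤i) (≤-reflexive (m+[n∸m]≡n i≤m))

Option⇒tokens< : ∀ {p q} → Option p q → tokens q < tokens p
Option⇒tokens< {x , y , z₁ , z₂} (move-v₁ i 4≤i i≤x) = begin-strict
  tokens (x ∸ i , suc y , suc z₁ , suc z₂) <⟨ n<1+n _ ⟩
  suc (x ∸ i + (suc y + (suc z₁ + suc z₂))) ≡⟨ v₁-shuffle (x ∸ i) y z₁ z₂ ⟩
  4 + (x ∸ i) + (y + (z₁ + z₂))              ≤⟨ +-monoˡ-≤ _ (k+[m∸i]≤m 4≤i i≤x) ⟩
  tokens (x , y , z₁ , z₂)                   ∎
  where
  open ≤-Reasoning
  v₁-shuffle : ∀ a y z₁ z₂ → suc (a + (suc y + (suc z₁ + suc z₂))) ≡ 4 + a + (y + (z₁ + z₂))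
  v₁-shuffle = solve-∀
Option⇒tokens< {x , y , z₁ , z₂} (move-v₂ i 3≤i i≤y) = begin-strict
  tokens (x , y ∸ i , suc z₁ , suc z₂)       <⟨ n<1+n _ ⟩
  suc (x + (y ∸ i + (suc z₁ + suc z₂)))      ≡⟨ v₂-shuffle x (y ∸ i) z₁ z₂ ⟩
  x + (3 + (y ∸ i) + (z₁ + z₂))              ≤⟨ +-monoʳ-≤ x (+-monoˡ-≤ _ (k+[m∸i]≤m 3≤i i≤y)) ⟩
  tokens (x , y , z₁ , z₂)                   ∎
  where
  open ≤-Reasoning
  v₂-shuffle : ∀ x b z₁ z₂ → suc (x + (b + (suc z₁ + suc z₂))) ≡ x + (3 + b + (z₁ + z₂))
  v₂-shuffle = solve-∀
Option⇒tokens< {x , y , z₁ , z₂} (move-w₁ i 1≤i i≤z₁) =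
  +-monoʳ-< x (+-monoʳ-< y (+-monoˡ-< z₂ (k+[m∸i]≤m 1≤i i≤z₁)))
Option⇒tokens< {x , y , z₁ , z₂} (move-w₂ i 1≤i i≤z₂) =
  +-monoʳ-< x (+-monoʳ-< y (+-monoʳ-< z₁ (k+[m∸i]≤m 1≤i i≤z₂)))

Option-wellFounded : WellFounded (flip Option)
Option-wellFounded =
  Subrelation.wellFounded Option⇒tokens< (On.wellFounded tokens <-wellFounded)

IsP⇒¬IsN : ∀ {p} → IsP p → ¬ IsN p
IsP⇒¬IsN (isP options-N) (isN q p→q q-P) = IsP⇒¬IsN q-P (options-N q p→q)

module Kernel {S : Pred Pos 0ℓ}
              (independent : ∀ {p q} → S p → Option p q → ¬ S q)
              (absorbing : ∀ p → S p ⊎ ∃[ q ] Option p q × S q) where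

  S⇒IsP×∉S⇒IsN : ∀ p → (S p → IsP p) × (¬ S p → IsN p)
  S⇒IsP×∉S⇒IsN = All.wfRec Option-wellFounded 0ℓ _ step
    where
    step : ∀ p → (∀ {q} → Option p q → (S q → IsP q) × (¬ S q → IsN q)) →
           (S p → IsP p) × (¬ S p → IsN p)
    step p ih = S⇒IsP , ∉S⇒IsN
      where
      S⇒IsP : S p → IsP p
      S⇒IsP p∈S = isP λ q p→q → proj₂ (ih p→q) (independent p∈S p→q)
      ∉S⇒IsN : ¬ S p → IsN p
      ∉S⇒IsN p∉S with absorbing p
      ... | inj₁ p∈S = contradiction p∈S p∉S
      ... | inj₂ (q , p→q , q∈S) = isN q p→q (proj₁ (ih p→q) q∈S)

  IsP⇔S : ∀ p → IsP p ⇔ S p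
  IsP⇔S p = mk⇔ IsP⇒S (proj₁ (S⇒IsP×∉S⇒IsN p))
    where
    IsP⇒S : IsP p → S p
    IsP⇒S (isP options-N) with absorbing p
    ... | inj₁ p∈S = p∈S
    ... | inj₂ (q , p→q , q∈S) =
      contradiction (options-N q p→q) (IsP⇒¬IsN (proj₁ (S⇒IsP×∉S⇒IsN q) q∈S))

bandBase : ℕ → ℕ
bandBase x = 2 * (x / 4)

record InBand (x y : ℕ) : Set where
  constructor in-band
  field
    base≤y : bandBase x ≤ y
    y≤base+2 : y ≤ bandBase x + 2

data OffBand (x y : ℕ) : Set where
  below : y < bandBase x → OffBand x y
  above : bandBase x + 2 < y → OffBand x y

InBand⇒¬OffBand : ∀ {x y} → InBand x y → ¬ OffBand x y
InBand⇒¬OffBand (in-band base≤y _) (below y<base) = <⇒≱ y<base base≤y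
InBand⇒¬OffBand (in-band _ y≤base+2) (above base+2<y) = <⇒≱ base+2<y y≤base+2

InBand⊎OffBand : ∀ x y → InBand x y ⊎ OffBand x y
InBand⊎OffBand x y with bandBase x ≤? y | y ≤? bandBase x + 2
... | no base≰y | _ = inj₂ (below (≰⇒> base≰y))
... | yes _ | no y≰base+2 = inj₂ (above (≰⇒> y≰base+2))
... | yes base≤y | yes y≤base+2 = inj₁ (in-band base≤y y≤base+2)

bandBase-+4 : ∀ {m n} → 4 + n ≤ m → bandBase n + 2 ≤ bandBase m
bandBase-+4 {m} {n} 4+n≤m = begin
  2 * (n / 4) + 2       ≡⟨ *-distribˡ-+ 2 (n / 4) 1 ⟨
  2 * (n / 4 + 1)       ≡⟨ cong (2 *_) (+-distrib-/-∣ʳ n ∣-refl) ⟨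
  2 * ((n + 4) / 4)     ≤⟨ *-monoʳ-≤ 2 (/-monoˡ-≤ 4 (≤-trans (≤-reflexive (+-comm n 4)) 4+n≤m)) ⟩
  2 * (m / 4)           ∎
  where open ≤-Reasoning

move-v₁-leaves-band : ∀ {x y i} → InBand x y → 4 ≤ i → i ≤ x → OffBand (x ∸ i) (suc y)
move-v₁-leaves-band (in-band base≤y _) 4≤i i≤x =
  above (s≤s (≤-trans (bandBase-+4 (k+[m∸i]≤m 4≤i i≤x)) base≤y))

move-v₂-leaves-band : ∀ {x y i} → InBand x y → 3 ≤ i → i ≤ y → OffBand x (y ∸ i)
move-v₂-leaves-band {x} {y} {i} (in-band _ y≤base+2) 3≤i i≤y =
  below (+-cancelʳ-≤ 2 (suc (y ∸ i)) (bandBase x) (begin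
    suc (y ∸ i) + 2 ≡⟨ +-comm (suc (y ∸ i)) 2 ⟩
    3 + (y ∸ i)     ≤⟨ k+[m∸i]≤m 3≤i i≤y ⟩
    y               ≤⟨ y≤base+2 ⟩
    bandBase x + 2  ∎))
  where open ≤-Reasoning

to-v₁ : ∀ {x x' y z₁ z₂} → 4 + x' ≤ x → Option (x , y , z₁ , z₂) (x' , suc y , suc z₁ , suc z₂)
to-v₁ {x} {x'} 4+x'≤x = subst (λ t → Option _ (t , _)) (m∸[m∸n]≡n (m+n≤o⇒n≤o 4 4+x'≤x))
  (move-v₁ (x ∸ x') (m+n≤o⇒m≤o∸n 4 4+x'≤x) (m∸n≤m x x'))

to-v₂ : ∀ {x y y' z₁ z₂} → 3 + y' ≤ y → Option (x , y , z₁ , z₂) (x , y' , suc z₁ , suc z₂)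
to-v₂ {y = y} {y'} 3+y'≤y = subst (λ t → Option _ (_ , t , _)) (m∸[m∸n]≡n (m+n≤o⇒n≤o 3 3+y'≤y))
  (move-v₂ (y ∸ y') (m+n≤o⇒m≤o∸n 3 3+y'≤y) (m∸n≤m y y'))

to-w₁ : ∀ {x y z₁ z₁' z₂} → z₁' < z₁ → Option (x , y , z₁ , z₂) (x , y , z₁' , z₂)
to-w₁ {z₁ = z₁} {z₁'} z₁'<z₁ = subst (λ t → Option _ (_ , _ , t , _)) (m∸[m∸n]≡n (<⇒≤ z₁'<z₁))
  (move-w₁ (z₁ ∸ z₁') (m+n≤o⇒m≤o∸n 1 z₁'<z₁) (m∸n≤m z₁ z₁'))

to-w₂ : ∀ {x y z₁ z₂ z₂'} → z₂' < z₂ → Option (x , y , z₁ , z₂) (x , y , z₁ , z₂')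
to-w₂ {z₂ = z₂} {z₂'} z₂'<z₂ = subst (λ t → Option _ (_ , _ , _ , t)) (m∸[m∸n]≡n (<⇒≤ z₂'<z₂))
  (move-w₂ (z₂ ∸ z₂') (m+n≤o⇒m≤o∸n 1 z₂'<z₂) (m∸n≤m z₂ z₂'))

2*[n/2]≤n : ∀ n → 2 * (n / 2) ≤ n
2*[n/2]≤n n = ≤-trans (≤-reflexive (*-comm 2 (n / 2))) (m/n*n≤m n 2)

n≤1+2*[n/2] : ∀ n → n ≤ 1 + 2 * (n / 2)
n≤1+2*[n/2] n = begin
  n                 ≡⟨ m≡m%n+[m/n]*n n 2 ⟩
  n % 2 + n / 2 * 2 ≤⟨ +-monoˡ-≤ _ (m<1+n⇒m≤n (m%n<n n 2)) ⟩
  1 + n / 2 * 2     ≡⟨ cong suc (*-comm (n / 2) 2) ⟩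
  1 + 2 * (n / 2)   ∎
  where open ≤-Reasoning

InBand-rounded : ∀ y → InBand (y / 2 * 4) (suc y)
InBand-rounded y = in-band
  (subst (_≤ suc y) (sym base≡) (≤-trans (2*[n/2]≤n y) (n≤1+n y)))
  (subst (λ base → suc y ≤ base + 2) (sym base≡) (≤-trans (s≤s (n≤1+2*[n/2] y)) (≤-reflexive (+-comm 2 _))))
  where
  base≡ : bandBase (y / 2 * 4) ≡ 2 * (y / 2)
  base≡ = cong (2 *_) (m*n/n≡m (y / 2) 4)

enter-band : ∀ {x y z₁ z₂} → OffBand x y →
             ∃₂ λ x' y' → Option (x , y , z₁ , z₂) (x' , y' , suc z₁ , suc z₂) × InBand x' y'
enter-band {x} {y} (below y<base) = y / 2 * 4 , suc y , to-v₁ 4+y/2*4≤x , InBand-rounded y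
  where
  4+y/2*4≤x : suc (y / 2) * 4 ≤ x
  4+y/2*4≤x = ≤-trans (*-monoˡ-≤ 4 (*-cancelˡ-< 2 (y / 2) (x / 4) (≤-<-trans (2*[n/2]≤n y) y<base)))
                      (m/n*n≤m x 4)
enter-band {x} (above base+2<y) =
  x , bandBase x , to-v₂ (≤-trans (≤-reflexive (cong suc (+-comm 2 (bandBase x)))) base+2<y) ,
  in-band ≤-refl (m≤m+n (bandBase x) 2)

data Paired : Pred Pos 0ℓ where
  balanced : ∀ {x y z₁ z₂} → InBand x y → z₂ ≡ z₁ → Paired (x , y , z₁ , z₂)
  partnered : ∀ {x y z₁ z₂} → OffBand x y → z₂ ≡ partner z₁ → Paired (x , y , z₁ , z₂)

S⇒Paired : ∀ {p} → S₁ p ⊎ S₂ p → Paired p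
S⇒Paired (inj₁ ((base≤y , y≤base+2) , z₁⊕z₂≡0)) =
  balanced (in-band base≤y y≤base+2) (sym (⊕≡0⇒≡ z₁⊕z₂≡0))
S⇒Paired (inj₂ (inj₁ y<base , z₁⊕z₂≡1)) = partnered (below y<base) (⊕≡1⇒≡partner z₁⊕z₂≡1)
S⇒Paired (inj₂ (inj₂ base+2<y , z₁⊕z₂≡1)) = partnered (above base+2<y) (⊕≡1⇒≡partner z₁⊕z₂≡1)

Paired⇒S : ∀ {p} → Paired p → S₁ p ⊎ S₂ p
Paired⇒S {_ , _ , z , _} (balanced (in-band base≤y y≤base+2) refl) = inj₁ ((base≤y , y≤base+2) , n⊕n≡0 z)
Paired⇒S {_ , _ , z , _} (partnered (below y<base) refl) = inj₂ (inj₁ y<base , n⊕partner≡1 z)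
Paired⇒S {_ , _ , z , _} (partnered (above base+2<y) refl) = inj₂ (inj₂ base+2<y , n⊕partner≡1 z)

Paired-suc-suc⇒InBand : ∀ {x y z₁ z₂ x' y'} → Paired (x , y , z₁ , z₂) →
                        Paired (x' , y' , suc z₁ , suc z₂) → InBand x y × InBand x' y'
Paired-suc-suc⇒InBand (balanced inB _) (balanced inB' _) = inB , inB'
Paired-suc-suc⇒InBand {z₁ = z₁} (balanced _ refl) (partnered _ eq) =
  contradiction (sym eq) (partner≢ (suc z₁))
Paired-suc-suc⇒InBand {z₁ = z₁} (partnered _ refl) (balanced _ eq) =
  contradiction (suc-injective eq) (partner≢ z₁)
Paired-suc-suc⇒InBand {z₁ = z₁} (partnered _ refl) (partnered _ eq) =
  contradiction (sym eq) (partner-suc≢suc-partner z₁)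

Paired-unique₁ : ∀ {x y a a' b} → Paired (x , y , a , b) → Paired (x , y , a' , b) → a ≡ a'
Paired-unique₁ (balanced _ b≡a) (balanced _ b≡a') = trans (sym b≡a) b≡a'
Paired-unique₁ (partnered _ b≡pa) (partnered _ b≡pa') = partner-injective (trans (sym b≡pa) b≡pa')
Paired-unique₁ (balanced inB _) (partnered offB _) = contradiction offB (InBand⇒¬OffBand inB)
Paired-unique₁ (partnered offB _) (balanced inB _) = contradiction offB (InBand⇒¬OffBand inB)

Paired-unique₂ : ∀ {x y a b b'} → Paired (x , y , a , b) → Paired (x , y , a , b') → b ≡ b'
Paired-unique₂ (balanced _ b≡a) (balanced _ b'≡a) = trans b≡a (sym b'≡a)
Paired-unique₂ (partnered _ b≡pa) (partnered _ b'≡pa) = trans b≡pa (sym b'≡pa)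
Paired-unique₂ (balanced inB _) (partnered offB _) = contradiction offB (InBand⇒¬OffBand inB)
Paired-unique₂ (partnered offB _) (balanced inB _) = contradiction offB (InBand⇒¬OffBand inB)

Paired-independent : ∀ {p q} → Paired p → Option p q → ¬ Paired q
Paired-independent p∈ (move-v₁ i 4≤i i≤x) q∈ =
  let inB , inB' = Paired-suc-suc⇒InBand p∈ q∈
  in InBand⇒¬OffBand inB' (move-v₁-leaves-band inB 4≤i i≤x)
Paired-independent p∈ (move-v₂ i 3≤i i≤y) q∈ =
  let inB , inB' = Paired-suc-suc⇒InBand p∈ q∈
  in InBand⇒¬OffBand inB' (move-v₂-leaves-band inB 3≤i i≤y)
Paired-independent p∈ (move-w₁ i 1≤i i≤z₁) q∈ =
  <⇒≢ (k+[m∸i]≤m 1≤i i≤z₁) (sym (Paired-unique₁ p∈ q∈))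
Paired-independent p∈ (move-w₂ i 1≤i i≤z₂) q∈ =
  <⇒≢ (k+[m∸i]≤m 1≤i i≤z₂) (sym (Paired-unique₂ p∈ q∈))

pair-up : ∀ {f x y z₁ z₂} → Involutive f → (∀ n → f n ≤ suc n) → z₁ ≢ z₂ → z₂ ≢ f z₁ →
          ∃₂ λ z₁' z₂' → Option (x , y , z₁ , z₂) (x , y , z₁' , z₂') × z₂' ≡ f z₁'
pair-up {f} {z₁ = z₁} {z₂} f-inv f≤suc z₁≢z₂ z₂≢fz₁ with <-cmp z₁ z₂
... | tri< z₁<z₂ _ _ = z₁ , f z₁ , to-w₂ (≤∧≢⇒< (≤-trans (f≤suc z₁) z₁<z₂) (z₂≢fz₁ ∘ sym)) , refl
... | tri≈ _ z₁≡z₂ _ = contradiction z₁≡z₂ z₁≢z₂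
... | tri> _ _ z₂<z₁ = f z₂ , z₂ , to-w₁ (≤∧≢⇒< (≤-trans (f≤suc z₂) z₂<z₁) fz₂≢z₁) , sym (f-inv z₂)
  where
  fz₂≢z₁ : f z₂ ≢ z₁
  fz₂≢z₁ fz₂≡z₁ = z₂≢fz₁ (trans (sym (f-inv z₂)) (cong f fz₂≡z₁))

Paired-absorbing : ∀ p → Paired p ⊎ ∃[ q ] Option p q × Paired q
Paired-absorbing (x , y , z₁ , z₂) with InBand⊎OffBand x y
... | inj₁ inB with z₂ ≟ z₁
...   | yes z₂≡z₁ = inj₁ (balanced inB z₂≡z₁)
...   | no z₂≢z₁ =
  let z₁' , z₂' , p→q , z₂'≡z₁' = pair-up (λ _ → refl) n≤1+n (z₂≢z₁ ∘ sym) z₂≢z₁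
  in inj₂ ((x , y , z₁' , z₂') , p→q , balanced inB z₂'≡z₁')
Paired-absorbing (x , y , z₁ , z₂) | inj₂ offB with z₂ ≟ partner z₁ | z₁ ≟ z₂
... | yes z₂≡pz₁ | _ = inj₁ (partnered offB z₂≡pz₁)
... | no _ | yes refl =
  let x' , y' , p→q , inB' = enter-band offB
  in inj₂ ((x' , y' , suc z₁ , suc z₁) , p→q , balanced inB' refl)
... | no z₂≢pz₁ | no z₁≢z₂ =
  let z₁' , z₂' , p→q , z₂'≡pz₁' = pair-up partner-involutive partner≤suc z₁≢z₂ z₂≢pz₁
  in inj₂ ((x , y , z₁' , z₂') , p→q , partnered offB z₂'≡pz₁')

corollary10 : (p : Pos) → (IsP p → S₁ p ⊎ S₂ p) × (S₁ p ⊎ S₂ p → IsP p)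
corollary10 p = Paired⇒S ∘ to , from ∘ S⇒Paired
  where open Equivalence (Kernel.IsP⇔S Paired-independent Paired-absorbing p)
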